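{- A graph $\Gamma$ admits a non-trivial chromatically invariant $2$-edge-colouring in which every vertex is incident with both a red edge and a blue edge if and only if $\Gamma$ is the join of two graphs, each of which has no isolated vertices.
   Context: All graphs are finite, simple, with nonempty vertex set. The join $\Gamma_1\vee\Gamma_2$ of graphs $\Gamma_1,\Gamma_2$ is their disjoint union together with all edges between $V(\Gamma_1)$ and $V(\Gamma_2)$. A $2$-edge-colouring of $\Gamma$ is a triple $G=(\Gamma,R,B)$ with $R,B\subseteq E(\Gamma)$, $R\cap B=\emptyset$, $R\cup B=E(\Gamma)$ (red and blue edges). A $k$-colouring of $G$ is a proper vertex colouring $c:V(\Gamma)\to\{1,\dots,k\}$ of $\Gamma$ such that for every $ux\in R$ and $vy\in B$ (either endpoint may play the role of $u$, resp. $v$), $c(u)=c(v)$ implies $c(x)\ne c(y)$. $P(G,\lambda)$ is the polynomial whose value at each non-negative integer $k$ is the number of $k$-colourings of $G$. $G$ is chromatically invariant if $P(G,\lambda)=P(\Gamma,\lambda)$ (usual chromatic polynomial of $\Gamma$), and non-trivially chromatically invariant if moreover $R\ne\emptyset$ and $B\ne\emptyset$. -}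

module Defs where

open import Data.Nat using (ℕ; zero; suc; _+_)
open import Data.Bool using (Bool; true; false)
open import Data.Bool.Properties renaming (_≟_ to _≟ᵇ_)
open import Data.Fin using (Fin; splitAt)
open import Data.Fin.Properties using (all?) renaming (_≟_ to _≟ᶠ_)
open import Data.Vec using (Vec; []; _∷_; lookup)
open import Data.List using (List; [_]; concatMap; map; filter; length)
open import Data.List.Base using () renaming (allFin to allFinL)
open import Data.Sum using (_⊎_; inj₁; inj₂)
open import Data.Product using (Σ; ∃; ∃-syntax; _×_; _,_)
open import Relation.Binary.PropositionalEquality using (_≡_; _≢_; refl)
open import Relation.Nullary using (Dec; ¬_)
open import Relation.Nullary.Decidable using (_×-dec_; _→-dec_; ¬?)
open import Function.Bundles using (_↔_; Inverse)

record Graph (n : ℕ) : Set where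
  field
    adj    : Fin n → Fin n → Bool
    sym    : ∀ u v → adj u v ≡ adj v u
    irrefl : ∀ u → adj u u ≡ false
open Graph public

Edge : ∀ {n} → Graph n → Fin n → Fin n → Set
Edge Γ u v = adj Γ u v ≡ true

-- 2-edge-colourings.  'red u v ≡ true' means the edge uv (if it is an
-- edge) is red, otherwise blue.  Hence R ∩ B = ∅ and R ∪ B = E(Γ).

record EdgeColouring {n : ℕ} (Γ : Graph n) : Set where
  field
    red    : Fin n → Fin n → Bool
    redSym : ∀ u v → red u v ≡ red v u
open EdgeColouring public

Red : ∀ {n} {Γ : Graph n} → EdgeColouring Γ → Fin n → Fin n → Set
Red {Γ = Γ} G u v = Edge Γ u v × red G u v ≡ true

Blue : ∀ {n} {Γ : Graph n} → EdgeColouring Γ → Fin n → Fin n → Set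
Blue {Γ = Γ} G u v = Edge Γ u v × red G u v ≡ false

Proper : ∀ {n k} → Graph n → Vec (Fin k) n → Set
Proper Γ c = ∀ u v → Edge Γ u v → lookup c u ≢ lookup c v

IsColouring : ∀ {n k} {Γ : Graph n} → EdgeColouring Γ → Vec (Fin k) n → Set
IsColouring {Γ = Γ} G c =
  Proper Γ c ×
  (∀ u x v y → Red G u x → Blue G v y →
     lookup c u ≡ lookup c v → lookup c x ≢ lookup c y)

edge? : ∀ {n} (Γ : Graph n) u v → Dec (Edge Γ u v)
edge? Γ u v = adj Γ u v ≟ᵇ true

proper? : ∀ {n k} (Γ : Graph n) (c : Vec (Fin k) n) → Dec (Proper Γ c)
proper? Γ c = all? λ u → all? λ v →
  edge? Γ u v →-dec ¬? (lookup c u ≟ᶠ lookup c v)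

isColouring? : ∀ {n k} {Γ : Graph n} (G : EdgeColouring Γ) (c : Vec (Fin k) n) →
               Dec (IsColouring G c)
isColouring? {Γ = Γ} G c = proper? Γ c ×-dec
  (all? λ u → all? λ x → all? λ v → all? λ y →
    (edge? Γ u x ×-dec (red G u x ≟ᵇ true)) →-dec
    ((edge? Γ v y ×-dec (red G v y ≟ᵇ false)) →-dec
    ((lookup c u ≟ᶠ lookup c v) →-dec ¬? (lookup c x ≟ᶠ lookup c y))))

-- list of all maps V → {1..k}, each exactly once
allVecs : (k n : ℕ) → List (Vec (Fin k) n)
allVecs k zero    = [ [] ]
allVecs k (suc n) = concatMap (λ i → map (i ∷_) (allVecs k n)) (allFinL k)

chromNum : ∀ {n} → Graph n → ℕ → ℕ
chromNum {n} Γ k = length (filter (proper? Γ) (allVecs k n))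

edgeChromNum : ∀ {n} {Γ : Graph n} → EdgeColouring Γ → ℕ → ℕ
edgeChromNum {n} G k = length (filter (isColouring? G) (allVecs k n))

-- P(G, λ) = P(Γ, λ): both polynomials are determined by their values at
-- all non-negative integers k, so equality means equality at every k.
ChromInvariant : ∀ {n} {Γ : Graph n} → EdgeColouring Γ → Set
ChromInvariant {Γ = Γ} G = ∀ k → edgeChromNum G k ≡ chromNum Γ k

NonTrivChromInvariant : ∀ {n} {Γ : Graph n} → EdgeColouring Γ → Set
NonTrivChromInvariant G =
  ChromInvariant G × (∃[ u ] ∃[ v ] Red G u v) × (∃[ u ] ∃[ v ] Blue G u v)

EveryVertexRedBlue : ∀ {n} {Γ : Graph n} → EdgeColouring Γ → Set
EveryVertexRedBlue G = ∀ v → (∃[ x ] Red G v x) × (∃[ y ] Blue G v y)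

NoIsolated : ∀ {n} → Graph n → Set
NoIsolated Γ = ∀ v → ∃[ w ] Edge Γ v w

-- adjacency of the join on Fin (m₁ + m₂): first m₁ vertices are Γ₁,
-- the rest Γ₂
joinAdj : ∀ {m₁ m₂} → Graph m₁ → Graph m₂ → Fin (m₁ + m₂) → Fin (m₁ + m₂) → Bool
joinAdj {m₁} Γ₁ Γ₂ i j with splitAt m₁ i | splitAt m₁ j
... | inj₁ a | inj₁ b = adj Γ₁ a b
... | inj₂ a | inj₂ b = adj Γ₂ a b
... | inj₁ _ | inj₂ _ = true
... | inj₂ _ | inj₁ _ = true

joinSym : ∀ {m₁ m₂} (Γ₁ : Graph m₁) (Γ₂ : Graph m₂) i j →
          joinAdj Γ₁ Γ₂ i j ≡ joinAdj Γ₁ Γ₂ j i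
joinSym {m₁} Γ₁ Γ₂ i j with splitAt m₁ i | splitAt m₁ j
... | inj₁ a | inj₁ b = sym Γ₁ a b
... | inj₂ a | inj₂ b = sym Γ₂ a b
... | inj₁ _ | inj₂ _ = refl
... | inj₂ _ | inj₁ _ = refl

joinIrrefl : ∀ {m₁ m₂} (Γ₁ : Graph m₁) (Γ₂ : Graph m₂) i →
             joinAdj Γ₁ Γ₂ i i ≡ false
joinIrrefl {m₁} Γ₁ Γ₂ i with splitAt m₁ i
... | inj₁ a = irrefl Γ₁ a
... | inj₂ a = irrefl Γ₂ a

_∨ᴳ_ : ∀ {m₁ m₂} → Graph m₁ → Graph m₂ → Graph (m₁ + m₂)
Γ₁ ∨ᴳ Γ₂ = record { adj = joinAdj Γ₁ Γ₂ ; sym = joinSym Γ₁ Γ₂ ; irrefl = joinIrrefl Γ₁ Γ₂ }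

record _≅_ {n m : ℕ} (Γ : Graph n) (Δ : Graph m) : Set where
  field
    bij      : Fin n ↔ Fin m
    preserve : ∀ u v → adj Γ u v ≡ adj Δ (Inverse.to bij u) (Inverse.to bij v)

-- Γ is (isomorphic to) the join of two graphs (nonempty vertex sets),
-- each without isolated vertices
IsJoinNoIsolated : ∀ {n} → Graph n → Set
IsJoinNoIsolated {n} Γ =
  Σ ℕ λ m₁ → Σ ℕ λ m₂ → Σ (Graph (suc m₁)) λ Γ₁ → Σ (Graph (suc m₂)) λ Γ₂ →
    NoIsolated Γ₁ × NoIsolated Γ₂ × (Γ ≅ (Γ₁ ∨ᴳ Γ₂))

module Submission where

-- (⇒) Invariance means every proper colouring of Γ is a colouring of G (counting
-- filtered lists).  Hence there is no red px and blue qz with p, q and x, z each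
-- "mergeable" (equal or non-adjacent): merging q into p and z into x would give
-- a proper colouring violating the rule.  From this local rule: a vertex v of
-- minimum degree has a colour class N_c(v) joined to its complement; it is a
-- join side unless some x ∈ N_c(v) is isolated in it, and then both classes of
-- x are joined and one of them is a join side.  Sorting Fin N by the side turns
-- it into an isomorphism with the join of the two induced subgraphs.
-- (⇐) Colour Γ₁ ∨ Γ₂ red inside the sides and blue across: equal colours at the
-- starts of a red and a blue edge force a cross edge between their ends, so every
-- proper colouring is a colouring; no isolated vertices gives both colours.

open import Defs hiding (sym)
open import Data.Nat using (ℕ; zero; suc; _≤_)
open import Data.Nat.Properties using (≤-antisym)
open import Data.Bool using (Bool; true; false; not)
open import Data.Bool.Properties using (not-¬; ¬-not) renaming (_≟_ to _≟ᵇ_)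
open import Data.Fin using (Fin; zero; suc; splitAt; join)
open import Data.Fin.Properties using (all?; any?; ¬∀⟶∃¬; +↔⊎; splitAt-join)
  renaming (_≟_ to _≟ᶠ_)
open import Data.Vec using (Vec; []; _∷_; lookup; tabulate)
open import Data.Vec.Properties using (lookup∘tabulate)
open import Data.List using (filter; length; map)
open import Data.List.Base using (allFin)
open import Data.List.Properties using (filter-≐)
open import Data.List.Membership.Propositional using (_∈_)
open import Data.List.Membership.Propositional.Properties
  using (∈-allFin; ∈-concatMap⁺; ∈-map⁺; ∈-filter⁺; ∈-filter⁻)
open import Data.List.Relation.Unary.Any using (here)
import Data.List.Relation.Unary.Any as Any
import Data.List.Relation.Unary.All as All
open import Data.List.Relation.Binary.Sublist.Propositional using (_⊆_; ⊆-refl)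
open import Data.List.Relation.Binary.Sublist.Propositional.Properties
  using (filter⁺; length-mono-≤; to-≋)
open import Data.List.Relation.Binary.Equality.Propositional using (≋⇒≡)
open import Data.List.Extrema.Nat using (argmin; f[argmin]≤f[xs])
open import Data.Sum using (_⊎_; inj₁; inj₂; map₁; map₂)
open import Data.Product using (Σ; ∃; ∃₂; _×_; _,_; proj₁; proj₂)
open import Data.Empty using (⊥; ⊥-elim)
open import Function using (_∘_)
open import Function.Bundles using (_↔_; Inverse; _⇔_; mk⇔; mk↔ₛ′)
open import Function.Properties.Inverse using (↔-trans; ↔-sym)
open import Relation.Binary.PropositionalEquality
  using (_≡_; _≢_; refl; sym; trans; cong; cong₂; subst; module ≡-Reasoning)
open import Relation.Nullary using (Dec; yes; no; ¬_; does; contradiction)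
open import Relation.Nullary.Decidable using (_×-dec_; _→-dec_; ¬?; does-⇔)
open import Relation.Unary using (Decidable)

module FilterCount {A : Set} {P Q : A → Set} (P? : Decidable P) (Q? : Decidable Q)
                   (P⇒Q : ∀ {a} → P a → Q a) where

  filter-sublist : ∀ l → filter P? l ⊆ filter Q? l
  filter-sublist l = filter⁺ P? Q? {as = l} {bs = l} (λ { refl → P⇒Q }) ⊆-refl

  filter-length-≤ : ∀ l → length (filter P? l) ≤ length (filter Q? l)
  filter-length-≤ l = length-mono-≤ (filter-sublist l)

  filter-length-≡ : ∀ l → length (filter P? l) ≡ length (filter Q? l) →
                    ∀ {a} → a ∈ l → Q a → P a
  filter-length-≡ l same-length {a} a∈l qa = proj₂ (∈-filter⁻ P? {xs = l} a∈filterP)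
    where
    filters-equal : filter P? l ≡ filter Q? l
    filters-equal = ≋⇒≡ (to-≋ same-length (filter-sublist l))
    a∈filterP : a ∈ filter P? l
    a∈filterP = subst (a ∈_) (sym filters-equal) (∈-filter⁺ Q? a∈l qa)

∈-allVecs : ∀ k n (c : Vec (Fin k) n) → c ∈ allVecs k n
∈-allVecs k zero    []      = here refl
∈-allVecs k (suc n) (i ∷ c) =
  ∈-concatMap⁺ (λ j → map (j ∷_) (allVecs k n))
    (Any.map (λ { refl → ∈-map⁺ (i ∷_) (∈-allVecs k n c) }) (∈-allFin i))

module _ {n : ℕ} {Γ : Graph n} (G : EdgeColouring Γ) where

  ProperIsColouring : Set
  ProperIsColouring = ∀ {k} (c : Vec (Fin k) n) → Proper Γ c → IsColouring G c

  invariant⇒proper-is-colouring : ChromInvariant G → ProperIsColouring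
  invariant⇒proper-is-colouring invariant {k} c =
    FilterCount.filter-length-≡ (isColouring? G) (proper? Γ) proj₁
      (allVecs k n) (invariant k) (∈-allVecs k n c)

  proper-is-colouring⇒invariant : ProperIsColouring → ChromInvariant G
  proper-is-colouring⇒invariant proper⇒colouring k =
    cong length (filter-≐ (isColouring? G) (proper? Γ)
                          (proj₁ , λ {c} → proper⇒colouring c) (allVecs k n))

failed-implication : ∀ {A B : Set} → Dec A → ¬ (A → B) → A × ¬ B
failed-implication (yes a) ¬a→b = a , λ b → ¬a→b (λ _ → b)
failed-implication (no ¬a) ¬a→b = contradiction (λ a → contradiction a ¬a) ¬a→b

all₂-or-counterexample : ∀ {n} {R : Fin n → Fin n → Set} → (∀ a b → Dec (R a b)) →
                         (∀ a b → R a b) ⊎ ∃₂ λ a b → ¬ R a b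
all₂-or-counterexample {n} R? with all? (λ a → all? (R? a))
... | yes holds = inj₁ holds
... | no fails with ¬∀⟶∃¬ n _ (λ a → all? (R? a)) fails
... | a , fails-at-a with ¬∀⟶∃¬ n _ (R? a) fails-at-a
... | b , ¬Rab = inj₂ (a , b , ¬Rab)

Joined : ∀ {N} → Graph N → (Fin N → Set) → Set
Joined Γ S = ∀ a b → S a → ¬ S b → Edge Γ a b

NoIsolatedIn : ∀ {N} → Graph N → (Fin N → Set) → Set
NoIsolatedIn Γ S = ∀ a → S a → ∃ λ w → S w × Edge Γ a w

module Adjacency {N : ℕ} (Γ : Graph N) where

  edge-sym : ∀ {u v} → Edge Γ u v → Edge Γ v u
  edge-sym {u} {v} e = trans (Graph.sym Γ v u) e

  edge-irrefl : ∀ {u} → ¬ Edge Γ u u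
  edge-irrefl {u} e = contradiction (trans (sym (irrefl Γ u)) e) λ ()

  Mergeable : Fin N → Fin N → Set
  Mergeable u v = u ≡ v ⊎ ¬ Edge Γ u v

  mergeable-sym : ∀ {u v} → Mergeable u v → Mergeable v u
  mergeable-sym (inj₁ refl) = inj₁ refl
  mergeable-sym (inj₂ ¬uv)  = inj₂ (¬uv ∘ edge-sym)

  mergeable⇒¬edge : ∀ {u v} → Mergeable u v → ¬ Edge Γ u v
  mergeable⇒¬edge (inj₁ refl) = edge-irrefl
  mergeable⇒¬edge (inj₂ ¬uv)  = ¬uv

  joined-or-gap : ∀ {S : Fin N → Set} → Decidable S →
                  Joined Γ S ⊎ ∃₂ λ a b → S a × ¬ S b × ¬ Edge Γ a b
  joined-or-gap S? with all₂-or-counterexample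
                          (λ a b → S? a →-dec (¬? (S? b) →-dec edge? Γ a b))
  ... | inj₁ joined = inj₁ joined
  ... | inj₂ (a , b , gap) with failed-implication (S? a) gap
  ... | sa , gap′ with failed-implication (¬? (S? b)) gap′
  ... | ¬sb , ¬ab = inj₂ (a , b , sa , ¬sb , ¬ab)

  has-neighbour-in? : ∀ {S : Fin N → Set} → Decidable S →
                      ∀ a → Dec (S a → ∃ λ w → S w × Edge Γ a w)
  has-neighbour-in? S? a = S? a →-dec any? (λ w → S? w ×-dec edge? Γ a w)

  no-isolated-or-isolated : ∀ {S : Fin N → Set} → Decidable S →
    NoIsolatedIn Γ S ⊎ ∃ λ a → S a × (∀ w → S w → ¬ Edge Γ a w)
  no-isolated-or-isolated S? with all? (has-neighbour-in? S?)
  ... | yes none = inj₁ none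
  ... | no some with ¬∀⟶∃¬ N _ (has-neighbour-in? S?) some
  ... | a , isolated with failed-implication (S? a) isolated
  ... | sa , no-nbr = inj₂ (a , sa , λ w sw e → no-nbr (w , sw , e))

  degree : Fin N → ℕ
  degree u = length (filter (edge? Γ u) (allFin N))

  smaller-neighbourhood : ∀ {v b} → degree v ≤ degree b →
    (∀ z → Edge Γ b z → Edge Γ v z) → ∀ z → Edge Γ v z → Edge Γ b z
  smaller-neighbourhood {v} {b} v≤b b⊆v z =
    filter-length-≡ (allFin N) (≤-antisym (filter-length-≤ (allFin N)) v≤b) (∈-allFin z)
    where open FilterCount (edge? Γ b) (edge? Γ v) (λ {z} → b⊆v z)

-- Merging q into p and z into x (p, q and x, z mergeable, px and qz edges)
-- gives a proper colouring with Fin N colours that identifies both pairs.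
module Merging {N : ℕ} (Γ : Graph N) {p x q z : Fin N} (px : Edge Γ p x) (qz : Edge Γ q z)
               (pq : Adjacency.Mergeable Γ p q) (xz : Adjacency.Mergeable Γ x z) where
  open Adjacency Γ

  merge : Fin N → Fin N
  merge w with w ≟ᶠ q
  ... | yes _ = p
  ... | no _ with w ≟ᶠ z
  ...   | yes _ = x
  ...   | no _  = w

  data Fate (w : Fin N) : Set where
    to-p  : w ≡ q → merge w ≡ p → Fate w
    to-x  : w ≡ z → merge w ≡ x → Fate w
    fixed : merge w ≡ w → Fate w

  merge-q : merge q ≡ p
  merge-q with q ≟ᶠ q
  ... | yes _   = refl
  ... | no q≢q  = contradiction refl q≢q

  merge-z : merge z ≡ x
  merge-z with z ≟ᶠ q
  ... | yes z≡q = contradiction (subst (Edge Γ q) z≡q qz) edge-irrefl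
  ... | no _ with z ≟ᶠ z
  ...   | yes _   = refl
  ...   | no z≢z  = contradiction refl z≢z

  merge-other : ∀ {w} → w ≢ q → w ≢ z → merge w ≡ w
  merge-other {w} w≢q w≢z with w ≟ᶠ q
  ... | yes w≡q = contradiction w≡q w≢q
  ... | no _ with w ≟ᶠ z
  ...   | yes w≡z = contradiction w≡z w≢z
  ...   | no _    = refl

  merge-p : merge p ≡ p
  merge-p with p ≟ᶠ q
  ... | yes _ = refl
  ... | no _ with p ≟ᶠ z
  ...   | yes p≡z = contradiction (edge-sym (subst (Edge Γ q) (sym p≡z) qz)) (mergeable⇒¬edge pq)
  ...   | no _    = refl

  merge-x : merge x ≡ x
  merge-x with x ≟ᶠ q
  ... | yes x≡q = contradiction (subst (Edge Γ p) x≡q px) (mergeable⇒¬edge pq)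
  ... | no _ with x ≟ᶠ z
  ...   | yes _ = refl
  ...   | no _  = refl

  fate : ∀ w → Fate w
  fate w with w ≟ᶠ q
  ... | yes w≡q = to-p w≡q (trans (cong merge w≡q) merge-q)
  ... | no w≢q with w ≟ᶠ z
  ...   | yes w≡z = to-x w≡z (trans (cong merge w≡z) merge-z)
  ...   | no w≢z  = fixed (merge-other w≢q w≢z)

  p≢x : p ≢ x
  p≢x refl = edge-irrefl px

  merged⇒mergeable : ∀ a b → merge a ≡ merge b → Mergeable a b
  merged⇒mergeable a b eq with fate a | fate b
  ... | to-p refl _  | to-p refl _  = inj₁ refl
  ... | to-x refl _  | to-x refl _  = inj₁ refl
  ... | fixed ha     | fixed hb     = inj₁ (trans (sym ha) (trans eq hb))
  ... | to-p refl ha | fixed hb     = subst (Mergeable q) (trans (sym ha) (trans eq hb)) (mergeable-sym pq)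
  ... | fixed ha     | to-p refl hb = subst (λ w → Mergeable w q) (trans (sym hb) (trans (sym eq) ha)) pq
  ... | to-x refl ha | fixed hb     = subst (Mergeable z) (trans (sym ha) (trans eq hb)) (mergeable-sym xz)
  ... | fixed ha     | to-x refl hb = subst (λ w → Mergeable w z) (trans (sym hb) (trans (sym eq) ha)) xz
  ... | to-p refl ha | to-x refl hb = contradiction (trans (sym ha) (trans eq hb)) p≢x
  ... | to-x refl ha | to-p refl hb = contradiction (trans (sym hb) (trans (sym eq) ha)) p≢x

  merged-colouring : Vec (Fin N) N
  merged-colouring = tabulate merge

  merged-proper : Proper Γ merged-colouring
  merged-proper a b ab same-colour = mergeable⇒¬edge (merged⇒mergeable a b merge-ab) ab
    where
    merge-ab : merge a ≡ merge b
    merge-ab = trans (sym (lookup∘tabulate merge a)) (trans same-colour (lookup∘tabulate merge b))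

  identifies : ∀ a b → merge a ≡ merge b → lookup merged-colouring a ≡ lookup merged-colouring b
  identifies a b eq = trans (lookup∘tabulate merge a) (trans eq (sym (lookup∘tabulate merge b)))

  identifies-pq : lookup merged-colouring p ≡ lookup merged-colouring q
  identifies-pq = identifies p q (trans merge-p (sym merge-q))

  identifies-xz : lookup merged-colouring x ≡ lookup merged-colouring z
  identifies-xz = identifies x z (trans merge-x (sym merge-z))

-- A chromatically invariant colouring has no forbidden pair: the merged
-- colouring of a forbidden pair would be proper but not a colouring of G.
module _ {N : ℕ} {Γ : Graph N} (G : EdgeColouring Γ) where
  open Adjacency Γ

  NoForbiddenPair : Set
  NoForbiddenPair = ∀ {p x q z} → Red G p x → Blue G q z → Mergeable p q → Mergeable x z → ⊥

  invariant⇒no-forbidden-pair : ChromInvariant G → NoForbiddenPair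
  invariant⇒no-forbidden-pair invariant {p} {x} {q} {z} rpx bqz pq xz =
    proj₂ (invariant⇒proper-is-colouring G invariant merged-colouring merged-proper)
      p x q z rpx bqz identifies-pq identifies-xz
    where open Merging Γ (proj₁ rpx) (proj₁ bqz) pq xz

record JoinSplit {N : ℕ} (Γ : Graph N) : Set₁ where
  field
    Side      : Fin N → Set
    side?     : Decidable Side
    inside    : ∃ Side
    outside   : ∃ (¬_ ∘ Side)
    joined    : Joined Γ Side
    inner-nbr : NoIsolatedIn Γ Side
    outer-nbr : NoIsolatedIn Γ (¬_ ∘ Side)

module Structure {N : ℕ} {Γ : Graph N} (G : EdgeColouring Γ)
                 (no-forbidden : NoForbiddenPair G) where
  open Adjacency Γ

  Nbr : Bool → Fin N → Fin N → Set
  Nbr c y u = Edge Γ y u × red G y u ≡ c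

  nbr? : ∀ c y → Decidable (Nbr c y)
  nbr? c y u = edge? Γ y u ×-dec (red G y u ≟ᵇ c)

  nbr-sym : ∀ {c y u} → Nbr c y u → Nbr c u y
  nbr-sym {y = y} {u} (yu , r) = edge-sym yu , trans (redSym G u y) r

  red-blue-adjacent : ∀ {p x q z} → Red G p x → Blue G q z → Mergeable p q → Edge Γ x z
  red-blue-adjacent {x = x} {z = z} px qz pq with edge? Γ x z
  ... | yes xz = xz
  ... | no ¬xz = ⊥-elim (no-forbidden px qz pq (inj₂ ¬xz))

  opposite-neighbours : ∀ c {p q x z} → Mergeable p q → Nbr c p x → Nbr (not c) q z → Edge Γ x z
  opposite-neighbours true  pq px qz = red-blue-adjacent px qz pq
  opposite-neighbours false pq px qz = edge-sym (red-blue-adjacent qz px (mergeable-sym pq))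

  common-neighbour : ∀ {p q w} → Mergeable p q → Edge Γ w p → Edge Γ w q → red G w p ≡ red G w q
  common-neighbour {p} {q} {w} pq wp wq with red G w p in rp | red G w q in rq
  ... | true  | true  = refl
  ... | false | false = refl
  ... | true  | false = ⊥-elim (no-forbidden (nbr-sym (wp , rp)) (nbr-sym (wq , rq)) pq (inj₁ refl))
  ... | false | true  = ⊥-elim (no-forbidden (nbr-sym (wq , rq)) (nbr-sym (wp , rp)) (mergeable-sym pq) (inj₁ refl))

  nbr-transfer : ∀ {c p q w} → Mergeable p q → Edge Γ w p → Nbr c w q → Nbr c w p
  nbr-transfer pq wp (wq , r) = wp , trans (common-neighbour pq wp wq) r

  colour-clash : ∀ {c a b w} → Mergeable a b → Nbr c a w → Nbr (not c) b w → ⊥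
  colour-clash ab aw bw =
    not-¬ (proj₂ (nbr-transfer (mergeable-sym ab) (proj₁ (nbr-sym bw)) (nbr-sym aw)))
          (proj₂ (nbr-sym bw))

  isolated-member-joined : ∀ {c v x} → Joined Γ (Nbr c v) → Nbr c v x →
    (∀ w → Nbr c v w → ¬ Edge Γ x w) → ∀ d → Joined Γ (Nbr d x)
  isolated-member-joined {c} {v} {x} joined vx isolated d a b xa ¬xb with edge? Γ x b
  ... | yes x-b = opposite-neighbours d (inj₁ refl) xa (x-b , ¬-not (¬xb ∘ (x-b ,_)))
  ... | no ¬x-b with nbr? c v b
  ...   | no ¬vb = contradiction (joined x b vx ¬vb) ¬x-b
  ...   | yes vb = edge-sym (joined b a vb (λ va → isolated a va (proj₁ xa)))

  module MinimumDegree (v : Fin N) (minimal : ∀ u → degree v ≤ degree u) where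

    gap-not-adjacent : ∀ c {a b} → Nbr c v a → ¬ Nbr c v b → ¬ Edge Γ a b → ¬ Edge Γ v b
    gap-not-adjacent c {b = b} va ¬vb ¬ab v-b with red G v b ≟ᵇ c
    ... | yes r = ¬vb (v-b , r)
    ... | no r  = ¬ab (opposite-neighbours c (inj₁ refl) va (v-b , ¬-not r))

    -- such a b is adjacent to the whole other colour class of v, since otherwise
    -- N(b) ⊆ N(v) would be a proper inclusion, contradicting minimality
    gap-sees-other-class : ∀ c {a b} → Nbr c v a → ¬ Edge Γ v b → ¬ Edge Γ b a →
                           ∀ w → Nbr (not c) v w → Edge Γ b w
    gap-sees-other-class c {a} {b} va ¬vb ¬ba w vw with edge? Γ b w
    ... | yes bw = bw
    ... | no ¬bw = contradiction (smaller-neighbourhood (minimal b) b⊆v a (proj₁ va)) ¬ba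
      where
      missed : ∀ d → ∃ λ q → Nbr d v q × ¬ Edge Γ b q
      missed d with d ≟ᵇ c
      ... | yes refl = a , va , ¬ba
      ... | no d≢c   = w , subst (λ e → Nbr e v w) (sym (¬-not d≢c)) vw , ¬bw
      b⊆v : ∀ z → Edge Γ b z → Edge Γ v z
      b⊆v z bz with missed (not (red G b z))
      ... | q , vq , ¬bq = edge-sym (opposite-neighbours (red G b z) (inj₂ ¬bq) (bz , refl) (nbr-sym vq))

    -- If both classes had gaps (a, b) and (a′, b′), the red edge ab′ and the
    -- blue edge ba′ with a ≁ b would force b′ ~ a′, closing the second gap.
    some-class-joined : Σ Bool λ c → Joined Γ (Nbr c v)
    some-class-joined with joined-or-gap (nbr? true v) | joined-or-gap (nbr? false v)
    ... | inj₁ joined | _           = true , joined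
    ... | inj₂ _      | inj₁ joined = false , joined
    ... | inj₂ (a , b , va , ¬vb , ¬ab) | inj₂ (a′ , b′ , va′ , ¬vb′ , ¬a′b′) =
          ⊥-elim (¬a′b′ (edge-sym (opposite-neighbours true (inj₂ ¬ab) a-b′ (nbr-sym a′-b))))
      where
      ¬v-b : ¬ Edge Γ v b
      ¬v-b = gap-not-adjacent true va ¬vb ¬ab
      ¬v-b′ : ¬ Edge Γ v b′
      ¬v-b′ = gap-not-adjacent false va′ ¬vb′ ¬a′b′
      -- b′ meets the red class of v, so a sees b′ in red as it sees v;
      -- symmetrically a′ sees b in blue
      a-b′ : Nbr true a b′
      a-b′ = nbr-transfer (inj₂ (¬v-b′ ∘ edge-sym))
               (edge-sym (gap-sees-other-class false va′ ¬v-b′ (¬a′b′ ∘ edge-sym) a va))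
               (nbr-sym va)
      a′-b : Nbr false a′ b
      a′-b = nbr-transfer (inj₂ (¬v-b ∘ edge-sym))
               (edge-sym (gap-sees-other-class true va ¬v-b (¬ab ∘ edge-sym) a′ va′))
               (nbr-sym va′)

  module _ (red-blue : EveryVertexRedBlue G) where

    nbr-of : ∀ c y → ∃ (Nbr c y)
    nbr-of true  y = proj₁ (red-blue y)
    nbr-of false y = proj₂ (red-blue y)

    class-split : ∀ c y → Joined Γ (Nbr c y) → NoIsolatedIn Γ (Nbr c y) → JoinSplit Γ
    class-split c y joined inner = record
      { Side = Nbr c y ; side? = nbr? c y ; inside = nbr-of c y
      ; outside = y , edge-irrefl ∘ proj₁ ; joined = joined
      ; inner-nbr = inner ; outer-nbr = outer }
      where
      outer : NoIsolatedIn Γ (¬_ ∘ Nbr c y)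
      outer b ¬yb with edge? Γ y b
      ... | yes y-b = y , edge-irrefl ∘ proj₁ , edge-sym y-b
      ... | no ¬y-b with nbr-of (not c) b
      ...   | w , bw = w , (λ yw → colour-clash (inj₂ ¬y-b) yw bw) , proj₁ bw

    isolated-shares-neighbour : ∀ c {x x₁} → Nbr c x x₁ → (∀ w → Nbr c x w → ¬ Edge Γ x₁ w) →
                                ∃ λ y → Nbr (not c) x y × Nbr (not c) x₁ y
    isolated-shares-neighbour c {x} {x₁} xx₁ isolated with nbr-of (not c) x₁
    ... | y , x₁y with edge? Γ x y
    ...   | no ¬xy = ⊥-elim (colour-clash (inj₂ ¬xy) xx₁ (nbr-sym x₁y))
    ...   | yes xy with red G x y ≟ᵇ c
    ...     | yes r = contradiction (proj₁ x₁y) (isolated y (xy , r))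
    ...     | no r  = y , (xy , ¬-not r) , x₁y

    not-both-isolated : ∀ {x x₁ y₁} → Nbr true x x₁ → (∀ w → Nbr true x w → ¬ Edge Γ x₁ w) →
                        Nbr false x y₁ → (∀ w → Nbr false x w → ¬ Edge Γ y₁ w) → ⊥
    not-both-isolated {x₁ = x₁} {y₁} xx₁ isolated₁ xy₁ isolated₂
      with isolated-shares-neighbour true xx₁ isolated₁ | isolated-shares-neighbour false xy₁ isolated₂
    ... | y′ , xy′ , x₁y′ | x′ , xx′ , y₁x′ =
          colour-clash (inj₂ (isolated₂ y′ xy′)) y₁x₁ (nbr-sym x₁y′)
      where
      y₁x₁ : Nbr true y₁ x₁
      y₁x₁ = nbr-transfer (inj₂ (isolated₁ x′ xx′))
               (edge-sym (opposite-neighbours true (inj₁ refl) xx₁ xy₁)) y₁x′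

    split-at-joined-vertex : ∀ x → (∀ d → Joined Γ (Nbr d x)) → JoinSplit Γ
    split-at-joined-vertex x joined
      with no-isolated-or-isolated (nbr? true x) | no-isolated-or-isolated (nbr? false x)
    ... | inj₁ none | _         = class-split true x (joined true) none
    ... | inj₂ _    | inj₁ none = class-split false x (joined false) none
    ... | inj₂ (x₁ , xx₁ , isolated₁) | inj₂ (y₁ , xy₁ , isolated₂) =
          ⊥-elim (not-both-isolated xx₁ isolated₁ xy₁ isolated₂)

    split-from-joined-class : ∀ v → (Σ Bool λ c → Joined Γ (Nbr c v)) → JoinSplit Γ
    split-from-joined-class v (c , joined) with no-isolated-or-isolated (nbr? c v)
    ... | inj₁ none = class-split c v joined none
    ... | inj₂ (x , vx , isolated) = split-at-joined-vertex x (isolated-member-joined joined vx isolated)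

    join-split : Fin N → JoinSplit Γ
    join-split v₀ = split-from-joined-class v (MinimumDegree.some-class-joined v minimal)
      where
      v : Fin N
      v = argmin degree v₀ (allFin N)
      minimal : ∀ u → degree v ≤ degree u
      minimal u = All.lookup (f[argmin]≤f[xs] v₀ (allFin N)) (∈-allFin u)

record Partition {M : ℕ} (P : Fin M → Set) (a b : ℕ) : Set where
  field
    split     : Fin M ↔ (Fin a ⊎ Fin b)
    left-in   : ∀ i → P (Inverse.from split (inj₁ i))
    right-out : ∀ j → ¬ P (Inverse.from split (inj₂ j))

cons-inside : ∀ {M a b} {P : Fin (suc M) → Set} → P zero → Partition (P ∘ suc) a b →
              Partition P (suc a) b
cons-inside {M} {a} {b} {P} p0 π = record
  { split = mk↔ₛ′ to from to-from from-to ; left-in = left-in′ ; right-out = right-out }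
  where
  open Partition π
  open Inverse split renaming (to to to₀; from to from₀)
  to : Fin (suc M) → Fin (suc a) ⊎ Fin b
  to zero    = inj₁ zero
  to (suc u) = map₁ suc (to₀ u)
  from : Fin (suc a) ⊎ Fin b → Fin (suc M)
  from (inj₁ zero)    = zero
  from (inj₁ (suc i)) = suc (from₀ (inj₁ i))
  from (inj₂ j)       = suc (from₀ (inj₂ j))
  from-shift : ∀ s → from (map₁ suc s) ≡ suc (from₀ s)
  from-shift (inj₁ i) = refl
  from-shift (inj₂ j) = refl
  from-to : ∀ u → from (to u) ≡ u
  from-to zero    = refl
  from-to (suc u) = trans (from-shift (to₀ u)) (cong suc (strictlyInverseʳ u))
  to-from : ∀ s → to (from s) ≡ s
  to-from (inj₁ zero)    = refl
  to-from (inj₁ (suc i)) = cong (map₁ suc) (strictlyInverseˡ (inj₁ i))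
  to-from (inj₂ j)       = cong (map₁ suc) (strictlyInverseˡ (inj₂ j))
  left-in′ : ∀ i → P (from (inj₁ i))
  left-in′ zero    = p0
  left-in′ (suc i) = left-in i

cons-outside : ∀ {M a b} {P : Fin (suc M) → Set} → ¬ P zero → Partition (P ∘ suc) a b →
               Partition P a (suc b)
cons-outside {M} {a} {b} {P} ¬p0 π = record
  { split = mk↔ₛ′ to from to-from from-to ; left-in = left-in ; right-out = right-out′ }
  where
  open Partition π
  open Inverse split renaming (to to to₀; from to from₀)
  to : Fin (suc M) → Fin a ⊎ Fin (suc b)
  to zero    = inj₂ zero
  to (suc u) = map₂ suc (to₀ u)
  from : Fin a ⊎ Fin (suc b) → Fin (suc M)
  from (inj₁ i)       = suc (from₀ (inj₁ i))
  from (inj₂ zero)    = zero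
  from (inj₂ (suc j)) = suc (from₀ (inj₂ j))
  from-shift : ∀ s → from (map₂ suc s) ≡ suc (from₀ s)
  from-shift (inj₁ i) = refl
  from-shift (inj₂ j) = refl
  from-to : ∀ u → from (to u) ≡ u
  from-to zero    = refl
  from-to (suc u) = trans (from-shift (to₀ u)) (cong suc (strictlyInverseʳ u))
  to-from : ∀ s → to (from s) ≡ s
  to-from (inj₁ i)       = cong (map₂ suc) (strictlyInverseˡ (inj₁ i))
  to-from (inj₂ zero)    = refl
  to-from (inj₂ (suc j)) = cong (map₂ suc) (strictlyInverseˡ (inj₂ j))
  right-out′ : ∀ j → ¬ P (from (inj₂ j))
  right-out′ zero    = ¬p0
  right-out′ (suc j) = right-out j

partition : ∀ M {P : Fin M → Set} → Decidable P → ∃₂ λ a b → Partition P a b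
partition zero    P? = 0 , 0 , record
  { split = mk↔ₛ′ (λ ()) (λ { (inj₁ ()) ; (inj₂ ()) }) (λ { (inj₁ ()) ; (inj₂ ()) }) (λ ())
  ; left-in = λ () ; right-out = λ () }
partition (suc M) P? with partition M (P? ∘ suc) | P? zero
... | a , b , π | yes p0 = suc a , b , cons-inside p0 π
... | a , b , π | no ¬p0 = a , suc b , cons-outside ¬p0 π

joinAdj⊎ : ∀ {m₁ m₂} → Graph m₁ → Graph m₂ → Fin m₁ ⊎ Fin m₂ → Fin m₁ ⊎ Fin m₂ → Bool
joinAdj⊎ Γ₁ Γ₂ (inj₁ a) (inj₁ b) = adj Γ₁ a b
joinAdj⊎ Γ₁ Γ₂ (inj₂ a) (inj₂ b) = adj Γ₂ a b
joinAdj⊎ Γ₁ Γ₂ (inj₁ _) (inj₂ _) = true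
joinAdj⊎ Γ₁ Γ₂ (inj₂ _) (inj₁ _) = true

joinAdj-splitAt : ∀ {m₁ m₂} (Γ₁ : Graph m₁) (Γ₂ : Graph m₂) i j →
                  joinAdj Γ₁ Γ₂ i j ≡ joinAdj⊎ Γ₁ Γ₂ (splitAt m₁ i) (splitAt m₁ j)
joinAdj-splitAt {m₁} Γ₁ Γ₂ i j with splitAt m₁ i | splitAt m₁ j
... | inj₁ a | inj₁ b = refl
... | inj₁ a | inj₂ b = refl
... | inj₂ a | inj₁ b = refl
... | inj₂ a | inj₂ b = refl

joinAdj-join : ∀ {m₁ m₂} (Γ₁ : Graph m₁) (Γ₂ : Graph m₂) s t →
               joinAdj Γ₁ Γ₂ (join m₁ m₂ s) (join m₁ m₂ t) ≡ joinAdj⊎ Γ₁ Γ₂ s t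
joinAdj-join {m₁} {m₂} Γ₁ Γ₂ s t =
  trans (joinAdj-splitAt Γ₁ Γ₂ (join m₁ m₂ s) (join m₁ m₂ t))
        (cong₂ (joinAdj⊎ Γ₁ Γ₂) (splitAt-join m₁ m₂ s) (splitAt-join m₁ m₂ t))

induced : ∀ {N m} → Graph N → (Fin m → Fin N) → Graph m
induced Γ f = record
  { adj = λ i j → adj Γ (f i) (f j)
  ; sym = λ i j → Graph.sym Γ (f i) (f j)
  ; irrefl = λ i → irrefl Γ (f i) }

module SplitToJoin {N : ℕ} {Γ : Graph N} (σ : JoinSplit Γ) where
  open JoinSplit σ

  module Sorted {a b : ℕ} (π : Partition Side a b) where
    open Partition π
    open Inverse split using (to; from; strictlyInverseˡ; strictlyInverseʳ)

    Γ₁ : Graph a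
    Γ₁ = induced Γ (from ∘ inj₁)

    Γ₂ : Graph b
    Γ₂ = induced Γ (from ∘ inj₂)

    adj-from : ∀ s t → adj Γ (from s) (from t) ≡ joinAdj⊎ Γ₁ Γ₂ s t
    adj-from (inj₁ i) (inj₁ j) = refl
    adj-from (inj₂ i) (inj₂ j) = refl
    adj-from (inj₁ i) (inj₂ j) = joined _ _ (left-in i) (right-out j)
    adj-from (inj₂ i) (inj₁ j) = trans (Graph.sym Γ _ _) (joined _ _ (left-in j) (right-out i))

    locate-inside : ∀ w → Side w → ∃ λ i → from (inj₁ i) ≡ w
    locate-inside w sw with to w in eq
    ... | inj₁ i = i , trans (cong from (sym eq)) (strictlyInverseʳ w)
    ... | inj₂ j = contradiction (subst Side (sym (trans (cong from (sym eq)) (strictlyInverseʳ w))) sw)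
                                 (right-out j)

    locate-outside : ∀ w → ¬ Side w → ∃ λ j → from (inj₂ j) ≡ w
    locate-outside w ¬sw with to w in eq
    ... | inj₂ j = j , trans (cong from (sym eq)) (strictlyInverseʳ w)
    ... | inj₁ i = contradiction (subst Side (trans (cong from (sym eq)) (strictlyInverseʳ w)) (left-in i))
                                 ¬sw

    no-isolated₁ : NoIsolated Γ₁
    no-isolated₁ i with inner-nbr (from (inj₁ i)) (left-in i)
    ... | w , sw , e with locate-inside w sw
    ...   | j , refl = j , e

    no-isolated₂ : NoIsolated Γ₂
    no-isolated₂ i with outer-nbr (from (inj₂ i)) (right-out i)
    ... | w , ¬sw , e with locate-outside w ¬sw
    ...   | j , refl = j , e

    isomorphic : Γ ≅ (Γ₁ ∨ᴳ Γ₂)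
    isomorphic = record { bij = ↔-trans split (↔-sym +↔⊎) ; preserve = preserve }
      where
      open ≡-Reasoning
      preserve : ∀ u v → adj Γ u v ≡ joinAdj Γ₁ Γ₂ (join a b (to u)) (join a b (to v))
      preserve u v = begin
        adj Γ u v                                    ≡⟨ cong₂ (adj Γ) (sym (strictlyInverseʳ u)) (sym (strictlyInverseʳ v)) ⟩
        adj Γ (from (to u)) (from (to v))            ≡⟨ adj-from (to u) (to v) ⟩
        joinAdj⊎ Γ₁ Γ₂ (to u) (to v)                 ≡⟨ sym (joinAdj-join Γ₁ Γ₂ (to u) (to v)) ⟩
        joinAdj Γ₁ Γ₂ (join a b (to u)) (join a b (to v)) ∎

  -- both sides are nonempty, so the partition has sizes of the form suc m
  sorted-join : ∀ {a b} → Partition Side a b → Fin a → Fin b → IsJoinNoIsolated Γ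
  sorted-join {suc m₁} {suc m₂} π _ _ = m₁ , m₂ , Γ₁ , Γ₂ , no-isolated₁ , no-isolated₂ , isomorphic
    where open Sorted π

  split⇒join : IsJoinNoIsolated Γ
  split⇒join with partition N side?
  ... | a , b , π = sorted-join π (proj₁ (locate-inside (proj₁ inside) (proj₂ inside)))
                                  (proj₁ (locate-outside (proj₁ outside) (proj₂ outside)))
    where open Sorted π

isLeft : ∀ {A B : Set} → A ⊎ B → Bool
isLeft (inj₁ _) = true
isLeft (inj₂ _) = false

joinAdj⊎-cross : ∀ {m₁ m₂} (Γ₁ : Graph m₁) (Γ₂ : Graph m₂) s t →
                 isLeft s ≢ isLeft t → joinAdj⊎ Γ₁ Γ₂ s t ≡ true
joinAdj⊎-cross Γ₁ Γ₂ (inj₁ _) (inj₁ _) apart = contradiction refl apart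
joinAdj⊎-cross Γ₁ Γ₂ (inj₂ _) (inj₂ _) apart = contradiction refl apart
joinAdj⊎-cross Γ₁ Γ₂ (inj₁ _) (inj₂ _) apart = refl
joinAdj⊎-cross Γ₁ Γ₂ (inj₂ _) (inj₁ _) apart = refl

does-true : ∀ {A : Set} (a? : Dec A) → does a? ≡ true → A
does-true (yes a) _ = a

does-false : ∀ {A : Set} (a? : Dec A) → does a? ≡ false → ¬ A
does-false (no ¬a) _ = ¬a

module SideColouring {N m₁ m₂ : ℕ} {Γ : Graph N} {Γ₁ : Graph m₁} {Γ₂ : Graph m₂}
                     (iso : Γ ≅ (Γ₁ ∨ᴳ Γ₂)) where
  open _≅_ iso
  open Inverse bij using (to; from; strictlyInverseˡ)

  side : Fin N → Fin m₁ ⊎ Fin m₂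
  side u = splitAt m₁ (to u)

  onLeft : Fin N → Bool
  onLeft u = isLeft (side u)

  colouring : EdgeColouring Γ
  colouring = record
    { red    = λ u v → does (onLeft u ≟ᵇ onLeft v)
    ; redSym = λ u v → does-⇔ (mk⇔ sym sym) (onLeft u ≟ᵇ onLeft v) (onLeft v ≟ᵇ onLeft u) }

  adj-side : ∀ u v → adj Γ u v ≡ joinAdj⊎ Γ₁ Γ₂ (side u) (side v)
  adj-side u v = trans (preserve u v) (joinAdj-splitAt Γ₁ Γ₂ (to u) (to v))

  cross-edge : ∀ {u v} → onLeft u ≢ onLeft v → Edge Γ u v
  cross-edge {u} {v} apart = trans (adj-side u v) (joinAdj⊎-cross Γ₁ Γ₂ (side u) (side v) apart)

  -- if u, v share a colour they share a side; then x (with u) and y (across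
  -- from v) lie on different sides, so they are adjacent and coloured apart
  proper-is-colouring : ProperIsColouring colouring
  proper-is-colouring c proper = proper , colouring-rule
    where
    colouring-rule : ∀ u x v y → Red colouring u x → Blue colouring v y →
                     lookup c u ≡ lookup c v → lookup c x ≢ lookup c y
    colouring-rule u x v y (_ , ux) (_ , vy) cu≡cv with onLeft u ≟ᵇ onLeft v
    ... | no apart     = contradiction cu≡cv (proper u v (cross-edge apart))
    ... | yes together = proper x y (cross-edge x-y-apart)
      where
      x-y-apart : onLeft x ≢ onLeft y
      x-y-apart xy = does-false (onLeft v ≟ᵇ onLeft y) vy
        (trans (sym together) (trans (does-true (onLeft u ≟ᵇ onLeft x) ux) xy))

  invariant : ChromInvariant colouring
  invariant = proper-is-colouring⇒invariant colouring proper-is-colouring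

  position : ∀ t → side (from (join m₁ m₂ t)) ≡ t
  position t = trans (cong (splitAt m₁) (strictlyInverseˡ (join m₁ m₂ t))) (splitAt-join m₁ m₂ t)

  neighbour-at : ∀ u {s} t → side u ≡ s → joinAdj⊎ Γ₁ Γ₂ s t ≡ true →
                 ∃ λ w → Edge Γ u w × red colouring u w ≡ does (isLeft s ≟ᵇ isLeft t)
  neighbour-at u t us st = from (join m₁ m₂ t)
    , trans (adj-side u _) (trans (cong₂ (joinAdj⊎ Γ₁ Γ₂) us (position t)) st)
    , cong₂ (λ s t → does (isLeft s ≟ᵇ isLeft t)) us (position t)

  module _ (no-isolated₁ : NoIsolated Γ₁) (no-isolated₂ : NoIsolated Γ₂)
           (v₁ : Fin m₁) (v₂ : Fin m₂) where

    red-blue-at : ∀ u {s} → side u ≡ s →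
                  (∃ λ x → Red colouring u x) × (∃ λ y → Blue colouring u y)
    red-blue-at u {inj₁ i} us = neighbour-at u (inj₁ (proj₁ (no-isolated₁ i))) us (proj₂ (no-isolated₁ i))
                              , neighbour-at u (inj₂ v₂) us refl
    red-blue-at u {inj₂ j} us = neighbour-at u (inj₂ (proj₁ (no-isolated₂ j))) us (proj₂ (no-isolated₂ j))
                              , neighbour-at u (inj₁ v₁) us refl

    every-vertex-red-blue : EveryVertexRedBlue colouring
    every-vertex-red-blue u = red-blue-at u refl

theorem13 : (n : ℕ) (Γ : Graph (suc n)) →
    (Σ (EdgeColouring Γ) (λ G → NonTrivChromInvariant G × EveryVertexRedBlue G))
      ⇔ IsJoinNoIsolated Γ
theorem13 n Γ = mk⇔ forward backward
  where
  forward : Σ (EdgeColouring Γ) (λ G → NonTrivChromInvariant G × EveryVertexRedBlue G) →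
            IsJoinNoIsolated Γ
  forward (G , (invariant , _ , _) , red-blue) =
    SplitToJoin.split⇒join
      (Structure.join-split G (invariant⇒no-forbidden-pair G invariant) red-blue zero)

  backward : IsJoinNoIsolated Γ →
             Σ (EdgeColouring Γ) (λ G → NonTrivChromInvariant G × EveryVertexRedBlue G)
  backward (m₁ , m₂ , Γ₁ , Γ₂ , no-isolated₁ , no-isolated₂ , iso) =
    colouring , (invariant , (zero , proj₁ (red-blue zero)) , (zero , proj₂ (red-blue zero))) , red-blue
    where
    open SideColouring {Γ₁ = Γ₁} {Γ₂ = Γ₂} iso
    red-blue : EveryVertexRedBlue colouring
    red-blue = every-vertex-red-blue no-isolated₁ no-isolated₂ zero zero
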